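{- Let $b\ge 2$ be an integer. (1) For any subset $S$ of $\mathbb{Z}$ with $|S|\ge n$ (allowing $n=+\infty$) and any finite or infinite sequence $\mathbf{s}=(s_i)_{i=0}^n$ of elements of $S$, for $1\le m<n$, $$\sum_{k=1}^m\alpha_k(S,b,\mathbf{s})\ \ge\ \sum_{k=1}^m\alpha_k(S,b).$$ (2) Given a fixed $N\ge1$, if $(s_i)_{i=0}^N$ is the initial part of a $b$-ordering of $S$, then equality holds in the inequality of (1) for $1\le m\le N$.
   Context: For $a\in\mathbb{Z}$, $\operatorname{ord}_b(a):=\sup\{k\in\mathbb{N}: b^k\mid a\}$, so $\operatorname{ord}_b(0)=+\infty$. For a sequence $\mathbf{s}=(s_i)$ of elements of $S$ (an $S$-test sequence; repetitions allowed), $\alpha_k(S,b,\mathbf{s}):=\sum_{j=0}^{k-1}\operatorname{ord}_b(s_k-s_j)$. A $b$-ordering of a nonempty $S\subseteq\mathbb{Z}$ is an infinite sequence $\mathbf{a}=(a_i)_{i\ge0}$ in $S$ such that for every $i\ge1$, $\sum_{j<i}\operatorname{ord}_b(a_i-a_j)=\min_{a'\in S}\sum_{j<i}\operatorname{ord}_b(a'-a_j)$. The value $\alpha_k(S,b,\mathbf{a})$ is the same for every $b$-ordering $\mathbf{a}$ of $S$; this common value is denoted $\alpha_k(S,b)$. -}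

module Defs where

open import Data.Nat using (ℕ; zero; suc; _<_; _≤_)
import Data.Nat as N
open import Data.Nat.Divisibility using (_∣?_; quotient)
open import Data.Integer using (ℤ; _-_; ∣_∣)
open import Data.Fin using (Fin)
open import Data.Product using (Σ; _×_)
open import Function.Definitions using (Injective)
open import Relation.Binary.PropositionalEquality using (_≡_)
open import Relation.Nullary using (yes; no)

data ℕ∞ : Set where
  fin : ℕ → ℕ∞
  ∞   : ℕ∞

infixl 6 _+∞_
_+∞_ : ℕ∞ → ℕ∞ → ℕ∞
fin m +∞ fin n = fin (m N.+ n)
fin _ +∞ ∞     = ∞
∞     +∞ _     = ∞

infix 4 _≤∞_ _<∞_
data _≤∞_ : ℕ∞ → ℕ∞ → Set where
  fin≤fin : ∀ {m n} → m ≤ n → fin m ≤∞ fin n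
  _≤∞∞    : ∀ x → x ≤∞ ∞

data _<∞_ : ℕ∞ → ℕ∞ → Set where
  fin<fin : ∀ {m n} → m < n → fin m <∞ fin n
  fin<∞   : ∀ {m} → fin m <∞ ∞

ordF : ℕ → ℕ → ℕ → ℕ
ordF b zero    n = 0
ordF b (suc f) n with b ∣? n
... | yes p = suc (ordF b f (quotient p))
... | no  _ = 0

-- ord_b(a) = sup{k : b^k ∣ a}; +∞ for a = 0.  For a ≠ 0 and b ≥ 2 the
-- valuation is < |a|, so fuel |a| suffices.
ord : ℕ → ℤ → ℕ∞
ord b a with ∣ a ∣
... | zero  = ∞
... | suc n = fin (ordF b (suc n) (suc n))

sumBelow : ℕ → (ℕ → ℕ∞) → ℕ∞
sumBelow zero    f = fin 0
sumBelow (suc k) f = sumBelow k f +∞ f k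

sum1to : ℕ → (ℕ → ℕ∞) → ℕ∞
sum1to zero    f = fin 0
sum1to (suc m) f = sum1to m f +∞ f (suc m)

ordSum : ℕ → (ℕ → ℤ) → ℕ → ℤ → ℕ∞
ordSum b s i x = sumBelow i (λ j → ord b (x - s j))

-- α_k(S,b,s) = Σ_{j=0}^{k-1} ord_b(s_k - s_j)   (independent of S)
α : ℕ → (ℕ → ℤ) → ℕ → ℕ∞
α b s k = ordSum b s k (s k)

Subset : Set₁
Subset = ℤ → Set

IsBOrdering : Subset → ℕ → (ℕ → ℤ) → Set
IsBOrdering S b a =
  ((i : ℕ) → S (a i)) ×
  ((i : ℕ) → 1 ≤ i → (a' : ℤ) → S a' → ordSum b a i (a i) ≤∞ ordSum b a i a')

AtLeastFin : Subset → ℕ → Set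
AtLeastFin S k = Σ (Fin k → ℤ) (λ f → Injective _≡_ _≡_ f × ((i : Fin k) → S (f i)))

CardGE : Subset → ℕ∞ → Set
CardGE S (fin k) = AtLeastFin S k
CardGE S ∞       = (k : ℕ) → AtLeastFin S k

{-# OPTIONS --safe #-}
module Submission where

-- Read a finite sequence x₀, …, x_m backwards as a list and call the sum of
-- ord_b(x_i - x_j) over all pairs i < j its energy; the sums
-- α_1(S,b,s) + … + α_m(S,b,s) are exactly the energies of s₀, …, s_m.  The
-- energy is invariant under permutation, and ord_b satisfies the strong
-- triangle inequality min(ord(c - y), ord(c - r)) ≤ ord(r - y).  Given a list
-- R of elements of S, let r be the element of R closest to a_k; replacing r by
-- a_k does not increase the energy: against the rest of R by the strong
-- triangle inequality, against a_0, …, a_{k-1} by the minimality defining a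
-- b-ordering.  Iterating turns R into an initial segment of the b-ordering,
-- which gives (1); applying (1) in both directions gives (2).

open import Defs
open import Data.Nat using (ℕ; _≤_)
open import Data.Integer using (ℤ)
open import Data.Product using (_×_)
open import Relation.Binary.PropositionalEquality using (_≡_)

import Data.Nat as N
open N using (zero; suc; z≤n; s≤s; _^_; _<_; NonZero)
import Data.Nat.Properties as NP
open import Data.Nat.Divisibility as ND using (divides; _∣?_)
open import Data.Integer using (_-_; ∣_∣; +_)
import Data.Integer.Properties as ZP
import Data.Integer.Divisibility.Signed as ZS
open import Data.Integer.Tactic.RingSolver using (solve-∀)
open import Data.List using (List; []; _∷_; _++_; length)
import Data.List.Properties as LP
open import Data.List.Relation.Unary.All as All using (All; []; _∷_)
open import Data.List.Relation.Binary.Permutation.Propositional as ↭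
  using (_↭_; prep; swap; ↭-sym)
open import Data.List.Relation.Binary.Permutation.Propositional.Properties
  using (↭-length; All-resp-↭; ++⁺ʳ; shift)
open import Data.Product using (_,_; proj₁; ∃₂)
open import Data.Sum using (_⊎_; inj₁; inj₂)
open import Data.Empty using (⊥-elim)
open import Function using (_∘_)
open import Relation.Nullary using (yes; no)
open import Relation.Binary.Bundles using (Poset)
open import Relation.Binary.Structures using (IsPartialOrder)
open import Algebra.Structures using (IsCommutativeSemigroup)
open import Algebra.Bundles using (CommutativeSemigroup)
open import Relation.Binary.PropositionalEquality
  using (refl; sym; trans; cong; cong₂; subst; subst₂; isEquivalence; module ≡-Reasoning)
open import Relation.Binary.PropositionalEquality.Algebra using (isMagma)

+∞-identityˡ : ∀ x → fin 0 +∞ x ≡ x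
+∞-identityˡ (fin m) = refl
+∞-identityˡ ∞       = refl

+∞-comm : ∀ x y → x +∞ y ≡ y +∞ x
+∞-comm (fin m) (fin n) = cong fin (NP.+-comm m n)
+∞-comm (fin m) ∞       = refl
+∞-comm ∞       (fin n) = refl
+∞-comm ∞       ∞       = refl

+∞-assoc : ∀ x y z → (x +∞ y) +∞ z ≡ x +∞ (y +∞ z)
+∞-assoc (fin m) (fin n) (fin k) = cong fin (NP.+-assoc m n k)
+∞-assoc (fin m) (fin n) ∞       = refl
+∞-assoc (fin m) ∞       z       = refl
+∞-assoc ∞       y       z       = refl

+∞-isCommutativeSemigroup : IsCommutativeSemigroup _≡_ _+∞_
+∞-isCommutativeSemigroup = record
  { isSemigroup = record { isMagma = isMagma _+∞_ ; assoc = +∞-assoc }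
  ; comm        = +∞-comm
  }

+∞-commutativeSemigroup : CommutativeSemigroup _ _
+∞-commutativeSemigroup = record { isCommutativeSemigroup = +∞-isCommutativeSemigroup }

open import Algebra.Properties.CommutativeSemigroup +∞-commutativeSemigroup
  using (interchange; x∙yz≈y∙xz)

≤∞-refl : ∀ {x} → x ≤∞ x
≤∞-refl {fin m} = fin≤fin NP.≤-refl
≤∞-refl {∞}     = ∞ ≤∞∞

≤∞-trans : ∀ {x y z} → x ≤∞ y → y ≤∞ z → x ≤∞ z
≤∞-trans (fin≤fin p) (fin≤fin q) = fin≤fin (NP.≤-trans p q)
≤∞-trans p           (_ ≤∞∞)     = _ ≤∞∞

≤∞-antisym : ∀ {x y} → x ≤∞ y → y ≤∞ x → x ≡ y
≤∞-antisym (fin≤fin p) (fin≤fin q) = cong fin (NP.≤-antisym p q)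
≤∞-antisym (.∞ ≤∞∞)    (.∞ ≤∞∞)    = refl

≤∞-total : ∀ x y → x ≤∞ y ⊎ y ≤∞ x
≤∞-total (fin m) (fin n) with NP.≤-total m n
... | inj₁ m≤n = inj₁ (fin≤fin m≤n)
... | inj₂ n≤m = inj₂ (fin≤fin n≤m)
≤∞-total x ∞ = inj₁ (x ≤∞∞)
≤∞-total ∞ y = inj₂ (y ≤∞∞)

≤∞-isPartialOrder : IsPartialOrder _≡_ _≤∞_
≤∞-isPartialOrder = record
  { isPreorder = record
    { isEquivalence = isEquivalence
    ; reflexive     = λ { refl → ≤∞-refl }
    ; trans         = ≤∞-trans
    }
  ; antisym = ≤∞-antisym
  }

≤∞-poset : Poset _ _ _
≤∞-poset = record { isPartialOrder = ≤∞-isPartialOrder }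

+∞-mono-≤∞ : ∀ {x x' y y'} → x ≤∞ x' → y ≤∞ y' → x +∞ y ≤∞ x' +∞ y'
+∞-mono-≤∞ (fin≤fin p) (fin≤fin q) = fin≤fin (NP.+-mono-≤ p q)
+∞-mono-≤∞ (fin≤fin p) (_ ≤∞∞)     = _ ≤∞∞
+∞-mono-≤∞ (_ ≤∞∞)     q           = _ ≤∞∞

<∞⇒≤∞ : ∀ {x y} → x <∞ y → x ≤∞ y
<∞⇒≤∞ (fin<fin m<n) = fin≤fin (NP.<⇒≤ m<n)
<∞⇒≤∞ fin<∞         = _ ≤∞∞

≤∞-from-finite-lower-bounds : ∀ x y → (∀ k → fin k ≤∞ x → fin k ≤∞ y) → x ≤∞ y
≤∞-from-finite-lower-bounds x       ∞       h = x ≤∞∞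
≤∞-from-finite-lower-bounds (fin m) (fin n) h = h m ≤∞-refl
≤∞-from-finite-lower-bounds ∞       (fin n) h with h (suc n) (_ ≤∞∞)
... | fin≤fin n<n = ⊥-elim (NP.<-irrefl refl n<n)

module _ {b : ℕ} where

  ≤-ordF⇒∣ : ∀ f m k → k ≤ ordF b f m → (b ^ k) ND.∣ m
  ≤-ordF⇒∣ f       m zero    _ = ND.1∣ m
  ≤-ordF⇒∣ (suc f) m (suc k) k<ord with b ∣? m | k<ord
  ... | yes (divides q refl) | s≤s k≤ord =
    subst (ND._∣ q N.* b) (NP.*-comm (b ^ k) b) (ND.*-monoˡ-∣ b (≤-ordF⇒∣ f q k k≤ord))

  -- Since b ≥ 2, each division strictly decreases m, so fuel m suffices.
  ∣⇒≤-ordF : 2 ≤ b → ∀ f m k → 1 ≤ m → m ≤ f → (b ^ k) ND.∣ m → k ≤ ordF b f m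
  ∣⇒≤-ordF _ f m zero _ _ _ = z≤n
  ∣⇒≤-ordF _ zero m (suc k) 1≤m m≤0 _ = ⊥-elim (NP.<-irrefl refl (NP.≤-trans 1≤m m≤0))
  ∣⇒≤-ordF 2≤b (suc f) m (suc k) 1≤m m≤f bᵏ⁺¹∣m with b ∣? m
  ... | no b∤m = ⊥-elim (b∤m (ND.∣-trans (ND.m∣m*n (b ^ k)) bᵏ⁺¹∣m))
  ... | yes (divides zero refl) = ⊥-elim (NP.<-irrefl refl 1≤m)
  ... | yes (divides q@(suc _) refl) =
    s≤s (∣⇒≤-ordF 2≤b f q k (s≤s z≤n) q≤f bᵏ∣q)
    where
    instance
      b-nonZero : NonZero b
      b-nonZero = N.>-nonZero (NP.≤-trans (s≤s z≤n) 2≤b)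
    q≤f : q ≤ f
    q≤f = NP.≤-pred (NP.≤-trans (NP.m<m*n q b 2≤b) m≤f)
    bᵏ∣q : (b ^ k) ND.∣ q
    bᵏ∣q = ND.*-cancelˡ-∣ b (subst (b N.* b ^ k ND.∣_) (NP.*-comm q b) bᵏ⁺¹∣m)

  ≤-ord⇒∣ : ∀ a k → fin k ≤∞ ord b a → (b ^ k) ND.∣ ∣ a ∣
  ≤-ord⇒∣ a k k≤ord with ∣ a ∣ | k≤ord
  ... | zero  | _           = ND._∣0 _
  ... | suc n | fin≤fin k≤n = ≤-ordF⇒∣ (suc n) (suc n) k k≤n

  ∣⇒≤-ord : 2 ≤ b → ∀ a k → (b ^ k) ND.∣ ∣ a ∣ → fin k ≤∞ ord b a
  ∣⇒≤-ord 2≤b a k bᵏ∣a with ∣ a ∣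
  ... | zero  = _ ≤∞∞
  ... | suc n = fin≤fin (∣⇒≤-ordF 2≤b (suc n) (suc n) k (s≤s z≤n) NP.≤-refl bᵏ∣a)

  ord-sym : ∀ x y → ord b (x - y) ≡ ord b (y - x)
  ord-sym x y rewrite ZP.∣i-j∣≡∣j-i∣ x y = refl

  ord-ultrametric : 2 ≤ b → ∀ c r y →
    ord b (c - y) ≤∞ ord b (c - r) → ord b (c - y) ≤∞ ord b (r - y)
  ord-ultrametric 2≤b c r y cy≤cr = ≤∞-from-finite-lower-bounds _ _ λ k k≤cy →
    ∣⇒≤-ord 2≤b (r - y) k
      (subst (λ z → (b ^ k) ND.∣ ∣ z ∣) (difference-of-differences c y r)
        (ZS.∣⇒∣ᵤ (ZS.∣m∣n⇒∣m-n {+ (b ^ k)} {c - y} {c - r}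
          (ZS.∣ᵤ⇒∣ (≤-ord⇒∣ (c - y) k k≤cy))
          (ZS.∣ᵤ⇒∣ (≤-ord⇒∣ (c - r) k (≤∞-trans k≤cy cy≤cr))))))
    where
    difference-of-differences : ∀ c y r → (c - y) - (c - r) ≡ r - y
    difference-of-differences = solve-∀

prefix : {A : Set} → (ℕ → A) → ℕ → List A
prefix s zero    = []
prefix s (suc k) = s k ∷ prefix s k

length-prefix : {A : Set} (s : ℕ → A) (k : ℕ) → length (prefix s k) ≡ k
length-prefix s zero    = refl
length-prefix s (suc k) = cong suc (length-prefix s k)

All-prefix : {A : Set} {P : A → Set} (s : ℕ → A) (k : ℕ) →
  (∀ i → i < k → P (s i)) → All P (prefix s k)
All-prefix s zero    P-s = []
All-prefix s (suc k) P-s = P-s k NP.≤-refl ∷ All-prefix s k (λ i i<k → P-s i (NP.m≤n⇒m≤1+n i<k))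

prefix-cong : {A : Set} (s t : ℕ → A) (k : ℕ) →
  (∀ i → i < k → s i ≡ t i) → prefix s k ≡ prefix t k
prefix-cong s t zero    s≡t = refl
prefix-cong s t (suc k) s≡t =
  cong₂ _∷_ (s≡t k NP.≤-refl) (prefix-cong s t k (λ i i<k → s≡t i (NP.m≤n⇒m≤1+n i<k)))

module Energy {A : Set} (v : A → A → ℕ∞)
  (v-sym : ∀ x y → v x y ≡ v y x)
  (v-ultrametric : ∀ c r y → v c y ≤∞ v c r → v c y ≤∞ v r y)
  where

  potential : A → List A → ℕ∞
  potential x []       = fin 0
  potential x (y ∷ ys) = v x y +∞ potential x ys

  energy : List A → ℕ∞
  energy []       = fin 0
  energy (x ∷ xs) = potential x xs +∞ energy xs

  potential-++ : ∀ x ys zs → potential x (ys ++ zs) ≡ potential x ys +∞ potential x zs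
  potential-++ x []       zs = sym (+∞-identityˡ (potential x zs))
  potential-++ x (y ∷ ys) zs = trans (cong (v x y +∞_) (potential-++ x ys zs))
    (sym (+∞-assoc (v x y) (potential x ys) (potential x zs)))

  potential-↭ : ∀ x {ys zs} → ys ↭ zs → potential x ys ≡ potential x zs
  potential-↭ x ↭.refl          = refl
  potential-↭ x (prep y p)      = cong (v x y +∞_) (potential-↭ x p)
  potential-↭ x (swap y z p)    = trans (cong (λ t → v x y +∞ (v x z +∞ t)) (potential-↭ x p))
    (x∙yz≈y∙xz (v x y) (v x z) _)
  potential-↭ x (↭.trans p q)   = trans (potential-↭ x p) (potential-↭ x q)

  energy-↭ : ∀ {xs ys} → xs ↭ ys → energy xs ≡ energy ys
  energy-↭ ↭.refl        = refl
  energy-↭ (prep x p)    = cong₂ _+∞_ (potential-↭ x p) (energy-↭ p)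
  energy-↭ {x ∷ y ∷ xs} {_ ∷ _ ∷ ys} (swap x y p) = begin
    (v x y +∞ potential x xs) +∞ (potential y xs +∞ energy xs)
      ≡⟨ interchange (v x y) (potential x xs) (potential y xs) (energy xs) ⟩
    (v x y +∞ potential y xs) +∞ (potential x xs +∞ energy xs)
      ≡⟨ cong₂ (λ d e → (d +∞ potential y xs) +∞ (potential x xs +∞ e)) (v-sym x y) (energy-↭ p) ⟩
    (v y x +∞ potential y xs) +∞ (potential x xs +∞ energy ys)
      ≡⟨ cong₂ (λ py px → (v y x +∞ py) +∞ (px +∞ energy ys)) (potential-↭ y p) (potential-↭ x p) ⟩
    (v y x +∞ potential y ys) +∞ (potential x ys +∞ energy ys) ∎
    where open ≡-Reasoning
  energy-↭ (↭.trans p q) = trans (energy-↭ p) (energy-↭ q)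

  potential-mono : ∀ {x z} ys → All (λ y → v x y ≤∞ v z y) ys → potential x ys ≤∞ potential z ys
  potential-mono []       []           = ≤∞-refl
  potential-mono (y ∷ ys) (xy≤zy ∷ ≤s) = +∞-mono-≤∞ xy≤zy (potential-mono ys ≤s)

  closest-to : ∀ c x xs → ∃₂ λ r R → (x ∷ xs ↭ r ∷ R) × All (λ y → v c y ≤∞ v c r) R
  closest-to c x []        = x , [] , ↭.refl , []
  closest-to c x (x' ∷ xs) with closest-to c x' xs
  ... | r , R , p , closer with ≤∞-total (v c x) (v c r)
  ...   | inj₁ x≤r = r , x ∷ R , ↭.trans (prep x p) (swap x r ↭.refl) , x≤r ∷ closer
  ...   | inj₂ r≤x = x , r ∷ R , prep x p , r≤x ∷ All.map (λ y≤r → ≤∞-trans y≤r r≤x) closer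

  Greedy : (A → Set) → (ℕ → A) → Set
  Greedy S a = ∀ k r → S r → potential (a k) (prefix a k) ≤∞ potential r (prefix a k)

  module _ {S : A → Set} {a : ℕ → A} (greedy : Greedy S a) where

    open import Relation.Binary.Reasoning.PartialOrder ≤∞-poset

    energy-exchange : ∀ k r R → S r → All (λ y → v (a k) y ≤∞ v (a k) r) R →
      energy (a k ∷ R ++ prefix a k) ≤∞ energy (r ∷ R ++ prefix a k)
    energy-exchange k r R S-r closer = +∞-mono-≤∞ (begin
      potential (a k) (R ++ L)            ≡⟨ potential-++ (a k) R L ⟩
      potential (a k) R +∞ potential (a k) L
        ≤⟨ +∞-mono-≤∞ (potential-mono R (All.map (v-ultrametric (a k) r _) closer)) (greedy k r S-r) ⟩
      potential r R +∞ potential r L      ≡⟨ potential-++ r R L ⟨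
      potential r (R ++ L)                ∎) ≤∞-refl
      where L = prefix a k

    greedy-energy-≤ : ∀ n k R → length R ≡ n → All S R →
      energy (prefix a (n N.+ k)) ≤∞ energy (R ++ prefix a k)
    greedy-energy-≤ zero    k []       _   _   = ≤∞-refl
    greedy-energy-≤ (suc n) k (x ∷ xs) len S-R with closest-to (a k) x xs
    ... | r , R , p , closer = begin
      energy (prefix a (suc n N.+ k))   ≡⟨ cong (energy ∘ prefix a) (NP.+-suc n k) ⟨
      energy (prefix a (n N.+ suc k))   ≤⟨ greedy-energy-≤ n (suc k) R length-R (All.tail S-rR) ⟩
      energy (R ++ a k ∷ prefix a k)    ≡⟨ energy-↭ (shift (a k) R (prefix a k)) ⟩
      energy (a k ∷ R ++ prefix a k)    ≤⟨ energy-exchange k r R (All.head S-rR) closer ⟩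
      energy (r ∷ R ++ prefix a k)      ≡⟨ energy-↭ (++⁺ʳ (prefix a k) (↭-sym p)) ⟩
      energy (x ∷ xs ++ prefix a k)     ∎
      where
      S-rR : All S (r ∷ R)
      S-rR = All-resp-↭ p S-R
      length-R : length R ≡ n
      length-R = NP.suc-injective (trans (sym (↭-length p)) len)

    greedy-minimises-energy : ∀ n R → length R ≡ n → All S R → energy (prefix a n) ≤∞ energy R
    greedy-minimises-energy n R len S-R =
      subst₂ _≤∞_ (cong (energy ∘ prefix a) (NP.+-identityʳ n)) (cong energy (LP.++-identityʳ R))
        (greedy-energy-≤ n 0 R len S-R)

module _ {b : ℕ} (2≤b : 2 ≤ b) where

  open Energy (λ x y → ord b (x - y)) ord-sym (ord-ultrametric 2≤b)

  potential-prefix≡ordSum : ∀ s k x → potential x (prefix s k) ≡ ordSum b s k x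
  potential-prefix≡ordSum s zero    x = refl
  potential-prefix≡ordSum s (suc k) x = trans (+∞-comm (ord b (x - s k)) _)
    (cong (_+∞ ord b (x - s k)) (potential-prefix≡ordSum s k x))

  sum1to-α≡energy : ∀ s m → sum1to m (α b s) ≡ energy (prefix s (suc m))
  sum1to-α≡energy s zero    = refl
  sum1to-α≡energy s (suc m) = trans (+∞-comm (sum1to m (α b s)) _)
    (cong₂ _+∞_ (sym (potential-prefix≡ordSum s (suc m) (s (suc m)))) (sum1to-α≡energy s m))

  sum1to-α-cong : ∀ m s t → (∀ i → i ≤ m → s i ≡ t i) → sum1to m (α b s) ≡ sum1to m (α b t)
  sum1to-α-cong m s t s≡t = begin
    sum1to m (α b s)            ≡⟨ sum1to-α≡energy s m ⟩
    energy (prefix s (suc m))   ≡⟨ cong energy (prefix-cong s t (suc m) (λ i i≤m → s≡t i (NP.≤-pred i≤m))) ⟩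
    energy (prefix t (suc m))   ≡⟨ sum1to-α≡energy t m ⟨
    sum1to m (α b t)            ∎
    where open ≡-Reasoning

  b-ordering⇒greedy : ∀ {S a} → IsBOrdering S b a → Greedy S a
  b-ordering⇒greedy _             zero    _ _   = ≤∞-refl
  b-ordering⇒greedy {a = a} (_ , minimal) (suc k) r S-r =
    subst₂ _≤∞_ (sym (potential-prefix≡ordSum a (suc k) (a (suc k))))
                (sym (potential-prefix≡ordSum a (suc k) r))
      (minimal (suc k) (s≤s z≤n) r S-r)

  b-ordering-minimises-sum1to-α : ∀ {S a} → IsBOrdering S b a →
    ∀ m s → (∀ i → i ≤ m → S (s i)) → sum1to m (α b a) ≤∞ sum1to m (α b s)
  b-ordering-minimises-sum1to-α {a = a} bo m s S-s =
    subst₂ _≤∞_ (sym (sum1to-α≡energy a m)) (sym (sum1to-α≡energy s m))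
      (greedy-minimises-energy (b-ordering⇒greedy bo) (suc m) (prefix s (suc m))
        (length-prefix s (suc m)) (All-prefix s (suc m) (λ i i≤m → S-s i (NP.≤-pred i≤m))))

theorem3p5 : (b : ℕ) → 2 ≤ b →
  -- (1)
  ((S : Subset) (n : ℕ∞) → CardGE S n →
    (s : ℕ → ℤ) → ((i : ℕ) → fin i ≤∞ n → S (s i)) →
    (m : ℕ) → 1 ≤ m → fin m <∞ n →
    (a : ℕ → ℤ) → IsBOrdering S b a →
    sum1to m (α b a) ≤∞ sum1to m (α b s))
  ×
  -- (2)
  ((S : Subset) (N : ℕ) → 1 ≤ N →
    (s : ℕ → ℤ) (a' : ℕ → ℤ) → IsBOrdering S b a' →
    ((i : ℕ) → i ≤ N → s i ≡ a' i) →
    (m : ℕ) → 1 ≤ m → m ≤ N →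
    (a : ℕ → ℤ) → IsBOrdering S b a →
    sum1to m (α b s) ≡ sum1to m (α b a))
theorem3p5 b 2≤b =
  -- Neither |S| ≥ n nor 1 ≤ m (resp. 1 ≤ N) is needed.
  (λ S n _ s S-s m _ m<n a bo →
    b-ordering-minimises-sum1to-α 2≤b bo m s
      (λ i i≤m → S-s i (≤∞-trans (fin≤fin i≤m) (<∞⇒≤∞ m<n))))
  ,
  (λ S N _ s a' bo' s≡a' m _ m≤N a bo →
    trans (sum1to-α-cong 2≤b m s a' (λ i i≤m → s≡a' i (NP.≤-trans i≤m m≤N)))
      (≤∞-antisym (b-ordering-minimises-sum1to-α 2≤b bo' m a (λ i _ → proj₁ bo i))
                  (b-ordering-minimises-sum1to-α 2≤b bo m a' (λ i _ → proj₁ bo' i))))
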